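{- Let $G$ be a CNF formula whose variables lie in a finite set $Z$, let $z\in Z$, and suppose $G$ has no $\{z\}$-removable boundary point. Let $C$ be a clause over $Z$. If $C$ is implied by $G$, or $z\notin\mathit{Vars}(C)$, then the formula $G\wedge C$ has no $\{z\}$-removable boundary point.
   Context: A point is a complete assignment to $Z$. $\mathit{Vars}(C)$ is the set of variables of clause $C$. For $Z'\subseteq Z$, a clause is a $Z'$-clause if it contains a variable of $Z'$, and a non-$Z'$-clause otherwise. A point $\boldsymbol{p}$ is a $Z'$-boundary point of a CNF formula $H$ if $H(\boldsymbol{p})=0$, every clause of $H$ falsified by $\boldsymbol{p}$ is a $Z'$-clause, and this property fails for every proper subset of $Z'$. A point $\boldsymbol{p}$ is a $Z'$-removable boundary point of $H$ if $\boldsymbol{p}$ is a $Z''$-boundary point of $H$ for some $Z''\subseteq Z'$ and there exists a clause $D$ falsified by $\boldsymbol{p}$ that is a non-$Z'$-clause and is implied by the conjunction of the $Z'$-clauses of $H$. -}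

module Defs where

open import Data.Nat using (ℕ)
open import Data.Fin using (Fin)
open import Data.Fin.Subset using (Subset; _∈_; _⊆_; _⊂_)
open import Data.Bool using (Bool; true; false; not; if_then_else_)
open import Data.List using (List; []; _∷_)
open import Data.List.Relation.Unary.Any using (Any)
open import Data.List.Membership.Propositional renaming (_∈_ to _∈ₗ_)
open import Data.Product using (Σ; ∃; _×_)
open import Relation.Binary.PropositionalEquality using (_≡_)
open import Relation.Nullary using (¬_)

-- The variable set Z is Fin n.  A literal is a variable with a polarity
-- (pos = true : positive literal x, pos = false : negative literal ¬x).
record Lit (n : ℕ) : Set where
  constructor lit
  field
    var : Fin n
    pos : Bool
open Lit public

Clause : ℕ → Set
Clause n = List (Lit n)

CNF : ℕ → Set
CNF n = List (Clause n)

Point : ℕ → Set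
Point n = Fin n → Bool

evalLit : ∀ {n} → Point n → Lit n → Bool
evalLit p l = if pos l then p (var l) else not (p (var l))

evalClause : ∀ {n} → Point n → Clause n → Bool
evalClause p [] = false
evalClause p (l ∷ C) = if evalLit p l then true else evalClause p C

evalCNF : ∀ {n} → Point n → CNF n → Bool
evalCNF p [] = true
evalCNF p (C ∷ H) = if evalClause p C then evalCNF p H else false

_∈Vars_ : ∀ {n} → Fin n → Clause n → Set
x ∈Vars C = Any (λ l → var l ≡ x) C

IsClauseOf : ∀ {n} → Subset n → Clause n → Set
IsClauseOf Z' C = ∃ λ x → x ∈ Z' × x ∈Vars C

BoundaryProp : ∀ {n} → Subset n → CNF n → Point n → Set
BoundaryProp Z' H p =
  evalCNF p H ≡ false ×
  (∀ C → C ∈ₗ H → evalClause p C ≡ false → IsClauseOf Z' C)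

IsBoundaryPoint : ∀ {n} → Subset n → CNF n → Point n → Set
IsBoundaryPoint Z' H p =
  BoundaryProp Z' H p × (∀ Z₀ → Z₀ ⊂ Z' → ¬ BoundaryProp Z₀ H p)

ImpliedByClausesOf : ∀ {n} → Subset n → CNF n → Clause n → Set
ImpliedByClausesOf {n} Z' H D =
  ∀ (q : Point n) → (∀ C → C ∈ₗ H → IsClauseOf Z' C → evalClause q C ≡ true)
    → evalClause q D ≡ true

IsRemovableBoundaryPoint : ∀ {n} → Subset n → CNF n → Point n → Set
IsRemovableBoundaryPoint {n} Z' H p =
  (∃ λ Z'' → Z'' ⊆ Z' × IsBoundaryPoint Z'' H p) ×
  (Σ (Clause n) λ D → evalClause p D ≡ false × ¬ IsClauseOf Z' D
                      × ImpliedByClausesOf Z' H D)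

NoRemovableBoundaryPoint : ∀ {n} → Subset n → CNF n → Set
NoRemovableBoundaryPoint Z' H = ∀ p → ¬ IsRemovableBoundaryPoint Z' H p

Implies : ∀ {n} → CNF n → Clause n → Set
Implies {n} H C = ∀ (q : Point n) → evalCNF q H ≡ true → evalClause q C ≡ true

module Submission where

-- Let p be a {z}-removable boundary point of H = G ∧ C: p is a
-- Z''-boundary point of H for some Z'' ⊆ {z}, and some clause D without z,
-- falsified by p, is implied by the z-clauses of H.  Then p is also a
-- {z}-removable boundary point of G, contradicting the hypothesis on G.
--   * Every clause of H falsified by p contains z.  Under either hypothesis on C,
--     every point that satisfies G and agrees with p off z also satisfies C.
--     Taking that point to be p itself shows G(p) = 0, so p is a Z''-boundary
--     point of G (minimality is automatic because Z'' ⊆ {z}).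
--   * No point q agreeing with p off z satisfies G: it would satisfy H, hence D,
--     whereas D does not mention z and p falsifies D.
--   * Hence the z-clauses of G imply the "cube clause" of p off z (the clause
--     over all variables except z that is falsified exactly by the points agreeing
--     with p off z); this clause is the new witness of removability.

open import Defs
open import Data.Nat using (ℕ)
open import Data.Fin using (Fin; _≟_)
open import Data.Fin.Subset using (⁅_⁆; Subset; _⊆_; _⊂_) renaming (_∈_ to _∈ₛ_)
open import Data.Fin.Subset.Properties using (x∈⁅x⁆; x∈⁅y⁆⇒x≡y)
open import Data.List using (List; []; _∷_; _++_; [_]; map; filter; allFin)
open import Data.List.Relation.Unary.Any using (here; there; any?)
import Data.List.Relation.Unary.Any as Any
open import Data.List.Relation.Unary.Any.Properties using (map⁻)
open import Data.List.Membership.Propositional renaming (_∈_ to _∈ₗ_)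
open import Data.List.Membership.Propositional.Properties
  using (∈-allFin; ∈-++⁺ˡ; ∈-++⁺ʳ; ∈-filter⁺; ∈-filter⁻)
open import Data.Bool using (true; false; not; if_then_else_; _∧_)
open import Data.Bool.Properties using (¬-not)
open import Data.Product using (∃; _×_; _,_)
open import Data.Sum using (_⊎_; inj₁; inj₂)
open import Data.Empty using (⊥; ⊥-elim)
open import Relation.Nullary using (¬_; yes; no)
open import Relation.Nullary.Decidable using (¬?)
open import Relation.Binary.PropositionalEquality
  using (_≡_; refl; sym; trans; subst; _≢_; module ≡-Reasoning)

private
  variable
    n : ℕ

AgreeOff : Fin n → Point n → Point n → Set
AgreeOff z q p = ∀ x → x ≢ z → q x ≡ p x

⊆⁅z⁆-clause⇒z∈Vars : {Z' : Subset n} {z : Fin n} {C : Clause n}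
                   → Z' ⊆ ⁅ z ⁆ → IsClauseOf Z' C → z ∈Vars C
⊆⁅z⁆-clause⇒z∈Vars {C = C} Z'⊆⁅z⁆ (x , x∈Z' , x∈C) =
  subst (_∈Vars C) (x∈⁅y⁆⇒x≡y _ (Z'⊆⁅z⁆ x∈Z')) x∈C

z∈Vars⇒⁅z⁆-clause : {z : Fin n} {C : Clause n} → z ∈Vars C → IsClauseOf ⁅ z ⁆ C
z∈Vars⇒⁅z⁆-clause {z = z} z∈C = z , x∈⁅x⁆ z , z∈C

cnf-false⇒falsified-clause : (p : Point n) (F : CNF n) → evalCNF p F ≡ false
                           → ∃ λ C → C ∈ₗ F × evalClause p C ≡ false
cnf-false⇒falsified-clause p (C ∷ F) F-false with evalClause p C in C-value
... | false = C , here refl , C-value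
... | true  = let (C' , C'∈F , C'-false) = cnf-false⇒falsified-clause p F F-false
              in C' , there C'∈F , C'-false

all-clauses-true⇒cnf-true : (p : Point n) (F : CNF n)
                          → (∀ C → C ∈ₗ F → evalClause p C ≡ true) → evalCNF p F ≡ true
all-clauses-true⇒cnf-true p []      all-true = refl
all-clauses-true⇒cnf-true p (C ∷ F) all-true rewrite all-true C (here refl) =
  all-clauses-true⇒cnf-true p F (λ C' C'∈F → all-true C' (there C'∈F))

evalCNF-++ : (p : Point n) (F F' : CNF n) → evalCNF p (F ++ F') ≡ evalCNF p F ∧ evalCNF p F'
evalCNF-++ p []      F' = refl
evalCNF-++ p (C ∷ F) F' with evalClause p C
... | true  = evalCNF-++ p F F'
... | false = refl

cnf-true⇒clause-true : (p : Point n) (F : CNF n) → evalCNF p F ≡ true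
                     → ∀ {C} → C ∈ₗ F → evalClause p C ≡ true
cnf-true⇒clause-true p (C ∷ F) F-true C'∈F with evalClause p C in C-value | C'∈F
... | true  | here refl  = C-value
... | true  | there C'∈F = cnf-true⇒clause-true p F F-true C'∈F

append-true : (p : Point n) (F : CNF n) (C : Clause n)
            → evalCNF p F ≡ true → evalClause p C ≡ true → evalCNF p (F ++ [ C ]) ≡ true
append-true p F C F-true C-true
  rewrite evalCNF-++ p F [ C ] | F-true | C-true = refl

prefix-falsified : (p : Point n) (F : CNF n) (C : Clause n)
                 → evalCNF p (F ++ [ C ]) ≡ false
                 → (evalCNF p F ≡ true → evalClause p C ≡ true)
                 → evalCNF p F ≡ false
prefix-falsified p F C FC-false C-follows with evalCNF p F in F-value
... | false = refl
... | true  = trans (sym (append-true p F C F-value (C-follows refl))) FC-false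

evalClause-local : (p q : Point n) (C : Clause n)
                 → (∀ x → x ∈Vars C → q x ≡ p x) → evalClause q C ≡ evalClause p C
evalClause-local p q []            agree = refl
evalClause-local p q (lit x b ∷ C) agree
  rewrite agree x (here refl)
        | evalClause-local p q C (λ y y∈C → agree y (there y∈C)) = refl

evalClause-off : (z : Fin n) (p q : Point n) (C : Clause n)
               → ¬ (z ∈Vars C) → AgreeOff z q p → evalClause q C ≡ evalClause p C
evalClause-off z p q C z∉C agree =
  evalClause-local p q C (λ x x∈C → agree x (λ { refl → z∉C x∈C }))

satisfied-off : (z : Fin n) (p q : Point n) (F : CNF n)
              → (∀ C → C ∈ₗ F → evalClause p C ≡ false → z ∈Vars C)
              → AgreeOff z q p
              → (∀ C → C ∈ₗ F → z ∈Vars C → evalClause q C ≡ true)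
              → ∀ C → C ∈ₗ F → evalClause q C ≡ true
satisfied-off z p q F falsified-contain-z agree z-clauses-true C C∈F
  with any? (λ l → var l ≟ z) C
... | yes z∈C = z-clauses-true C C∈F z∈C
... | no  z∉C = trans (evalClause-off z p q C z∉C agree)
                      (¬-not (λ C-false → z∉C (falsified-contain-z C C∈F C-false)))

-- The clause over the variables xs whose literals all disagree with p: it is
-- falsified precisely by the points that agree with p on xs.
cube : Point n → List (Fin n) → Clause n
cube p = map (λ x → lit x (not (p x)))

opposite-literal-false : ∀ b → (if not b then b else not b) ≡ false
opposite-literal-false true  = refl
opposite-literal-false false = refl

opposite-literal-false⇒equal : ∀ b c → (if not b then c else not c) ≡ false → c ≡ b
opposite-literal-false⇒equal true  true  _ = refl
opposite-literal-false⇒equal false false _ = refl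

cube-falsified : (p : Point n) (xs : List (Fin n)) → evalClause p (cube p xs) ≡ false
cube-falsified p []       = refl
cube-falsified p (x ∷ xs) rewrite opposite-literal-false (p x) = cube-falsified p xs

cube-vars : (p : Point n) (xs : List (Fin n)) {x : Fin n}
          → x ∈Vars cube p xs → x ∈ₗ xs
cube-vars p xs x∈cube = Any.map sym (map⁻ x∈cube)

cube-falsified⇒agree : (p q : Point n) (xs : List (Fin n))
                     → evalClause q (cube p xs) ≡ false → ∀ x → x ∈ₗ xs → q x ≡ p x
cube-falsified⇒agree p q (y ∷ xs) cube-false x x∈xs
  with evalLit q (lit y (not (p y))) in y-value | x∈xs
... | false | here refl  = opposite-literal-false⇒equal (p y) (q y) y-value
... | false | there x∈xs = cube-falsified⇒agree p q xs cube-false x x∈xs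

allBut : Fin n → List (Fin n)
allBut {n} z = filter (λ x → ¬? (x ≟ z)) (allFin n)

∈-allBut⁺ : {z x : Fin n} → x ≢ z → x ∈ₗ allBut z
∈-allBut⁺ {z = z} {x} = ∈-filter⁺ (λ y → ¬? (y ≟ z)) (∈-allFin x)

∈-allBut⁻ : {z x : Fin n} → x ∈ₗ allBut z → x ≢ z
∈-allBut⁻ {z = z} x∈allBut =
  let (_ , x≢z) = ∈-filter⁻ (λ y → ¬? (y ≟ z)) {xs = allFin _} x∈allBut in x≢z

offCube : Point n → Fin n → Clause n
offCube p z = cube p (allBut z)

offCube-non-z : (p : Point n) (z : Fin n) → ¬ IsClauseOf ⁅ z ⁆ (offCube p z)
offCube-non-z p z (x , x∈⁅z⁆ , x∈cube) =
  ∈-allBut⁻ (cube-vars p (allBut z) x∈cube) (x∈⁅y⁆⇒x≡y z x∈⁅z⁆)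

offCube-falsified⇒agree : (p q : Point n) (z : Fin n)
                        → evalClause q (offCube p z) ≡ false → AgreeOff z q p
offCube-falsified⇒agree p q z cube-false x x≢z =
  cube-falsified⇒agree p q (allBut z) cube-false x (∈-allBut⁺ x≢z)

offCube-implied : (z : Fin n) (p : Point n) (F : CNF n)
                → (∀ C → C ∈ₗ F → evalClause p C ≡ false → z ∈Vars C)
                → (∀ q → AgreeOff z q p → evalCNF q F ≡ true → ⊥)
                → ImpliedByClausesOf ⁅ z ⁆ F (offCube p z)
offCube-implied z p F falsified-contain-z no-flip q z-clauses-true
  with evalClause q (offCube p z) in cube-value
... | true  = refl
... | false = ⊥-elim (no-flip q agree (all-clauses-true⇒cnf-true q F F-true))
  where
  agree : AgreeOff z q p
  agree = offCube-falsified⇒agree p q z cube-value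

  F-true : ∀ C → C ∈ₗ F → evalClause q C ≡ true
  F-true = satisfied-off z p q F falsified-contain-z agree
             (λ C C∈F z∈C → z-clauses-true C C∈F (z∈Vars⇒⁅z⁆-clause z∈C))

-- Below a singleton, the minimality condition of a boundary point is automatic:
-- a proper subset of Z' ⊆ {z} is empty, and the falsified clause that exists
-- because F(p) = 0 cannot be a clause of the empty set.
boundary-below-singleton : {Z' : Subset n} {z : Fin n} {F : CNF n} {p : Point n}
                         → Z' ⊆ ⁅ z ⁆ → BoundaryProp Z' F p → IsBoundaryPoint Z' F p
boundary-below-singleton {Z' = Z'} {z} {F} {p} Z'⊆⁅z⁆ boundary = boundary , minimal
  where
  minimal : ∀ Z₀ → Z₀ ⊂ Z' → ¬ BoundaryProp Z₀ F p
  minimal Z₀ (Z₀⊆Z' , y , y∈Z' , y∉Z₀) (F-false , falsified-in-Z₀) =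
    let (C , C∈F , C-false) = cnf-false⇒falsified-clause p F F-false
        (x , x∈Z₀ , _)      = falsified-in-Z₀ C C∈F C-false
        x≡z                 = x∈⁅y⁆⇒x≡y z (Z'⊆⁅z⁆ (Z₀⊆Z' x∈Z₀))
        y≡z                 = x∈⁅y⁆⇒x≡y z (Z'⊆⁅z⁆ y∈Z')
    in y∉Z₀ (subst (_∈ₛ Z₀) (trans x≡z (sym y≡z)) x∈Z₀)

-- Under either hypothesis of the theorem,
-- every point q that agrees with p off z and satisfies G also satisfies C: either
-- G implies C, or C has no z, so C(q) = C(p), and C(p) = 1.
appended-clause-satisfied : {G : CNF n} {z : Fin n} {C : Clause n} {p q : Point n}
                          → Implies G C ⊎ ¬ (z ∈Vars C)
                          → (evalClause p C ≡ false → z ∈Vars C)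
                          → AgreeOff z q p → evalCNF q G ≡ true → evalClause q C ≡ true
appended-clause-satisfied {q = q} (inj₁ G⇒C) _ _ G-true = G⇒C q G-true
appended-clause-satisfied {z = z} {C} {p} {q} (inj₂ z∉C) falsified⇒z∈C agree _ =
  trans (evalClause-off z p q C z∉C agree)
        (¬-not (λ C-false → z∉C (falsified⇒z∈C C-false)))

proposition4 : (n : ℕ) (G : CNF n) (z : Fin n)
    → NoRemovableBoundaryPoint ⁅ z ⁆ G
    → (C : Clause n)
    → Implies G C ⊎ ¬ (z ∈Vars C)
    → NoRemovableBoundaryPoint ⁅ z ⁆ (G ++ [ C ])
proposition4 n G z G-has-none C hyp p
  ((Z'' , Z''⊆⁅z⁆ , (H-false , H-falsified) , _) , (D , D-false , D-non-z , D-implied)) =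
  G-has-none p
    ( (Z'' , Z''⊆⁅z⁆ , boundary-below-singleton Z''⊆⁅z⁆ (G-false , G-falsified))
    , (offCube p z , cube-falsified p (allBut z) , offCube-non-z p z
      , offCube-implied z p G (λ C' C'∈G → falsified-contain-z C' (∈-++⁺ˡ C'∈G)) no-flip ))
  where
  falsified-contain-z : ∀ C' → C' ∈ₗ G ++ [ C ] → evalClause p C' ≡ false → z ∈Vars C'
  falsified-contain-z C' C'∈H C'-false =
    ⊆⁅z⁆-clause⇒z∈Vars Z''⊆⁅z⁆ (H-falsified C' C'∈H C'-false)

  C-follows : ∀ q → AgreeOff z q p → evalCNF q G ≡ true → evalClause q C ≡ true
  C-follows q =
    appended-clause-satisfied {G = G} hyp (falsified-contain-z C (∈-++⁺ʳ G (here refl)))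

  G-false : evalCNF p G ≡ false
  G-false = prefix-falsified p G C H-false (C-follows p (λ _ _ → refl))

  G-falsified : ∀ C' → C' ∈ₗ G → evalClause p C' ≡ false → IsClauseOf Z'' C'
  G-falsified C' C'∈G = H-falsified C' (∈-++⁺ˡ C'∈G)

  -- A point q agreeing with p off z and satisfying G satisfies G ∧ C, hence D;
  -- but D does not mention z, so D(q) = D(p) = 0.
  no-flip : ∀ q → AgreeOff z q p → evalCNF q G ≡ true → ⊥
  no-flip q agree G-true = false≢true D-both-values
    where
    open ≡-Reasoning
    false≢true : false ≡ true → ⊥
    false≢true ()

    H-true : evalCNF q (G ++ [ C ]) ≡ true
    H-true = append-true q G C G-true (C-follows q agree G-true)

    D-lacks-z : ¬ (z ∈Vars D)
    D-lacks-z z∈D = D-non-z (z∈Vars⇒⁅z⁆-clause z∈D)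

    D-both-values : false ≡ true
    D-both-values = begin
      false            ≡⟨ sym D-false ⟩
      evalClause p D   ≡⟨ sym (evalClause-off z p q D D-lacks-z agree) ⟩
      evalClause q D   ≡⟨ D-implied q (λ C' C'∈H _ → cnf-true⇒clause-true q _ H-true C'∈H) ⟩
      true             ∎
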